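{- Let $\mathtt{c}$ be a cycle with vertex set $I$, $n=|I|$. Given integers $k\ge1$ and $j_2,\dots,j_{n-k+1}\ge 0$ with $$j_2+\dots+j_{n-k+1}\le k\quad\text{and}\quad k+1\cdot j_2+2j_3+\dots+(n-k)j_{n-k+1}=n,$$ set $j_1=k-(j_2+\dots+j_{n-k+1})$. Then the number of decompositions $I=S\sqcup T$ such that $|S|=k$ and the induced subgraph $\mathtt{c}:T$ splits into maximal intervals (connected components) whose multiset of numbers of vertices is $\{1^{j_2},2^{j_3},\dots,(n-k)^{j_{n-k+1}}\}$ equals $$\frac{n\,(k-1)!}{j_1!\,j_2!\cdots j_{n-k+1}!}.$$
   Context: $\mathtt{c}:T$ denotes the subgraph of $\mathtt{c}$ induced on the vertex set $T$; its connected components are sets of cyclically consecutive vertices (intervals) when $T\ne I$. -}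

module Defs where

open import Data.Nat using (ℕ; zero; suc; _+_; _*_; _∸_)
open import Data.Nat.DivMod using (_mod_)
open import Data.Bool using (Bool; true; false; _∧_; not)
open import Data.Fin using (Fin; toℕ)
open import Data.Fin.Subset using (Subset; ∣_∣)
open import Data.Vec using (Vec; []; _∷_; lookup)
open import Data.List using (List; []; _∷_; _++_; map; length; filterᵇ)

-- The cycle c on vertex set I = Fin n: vertex x is adjacent to x+1 and x-1 (mod n).
-- A decomposition I = S ⊔ T is determined by S : Subset n (T = complement of S).

allSubsets : (n : ℕ) → List (Subset n)
allSubsets zero = [] ∷ []
allSubsets (suc n) = map (true ∷_) (allSubsets n) ++ map (false ∷_) (allSubsets n)

inS : {n : ℕ} → Subset n → ℕ → Bool
inS {zero} S x = false
inS {suc n} S x = lookup S (x mod suc n)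

allInT : {n : ℕ} → Subset n → ℕ → ℕ → Bool
allInT S a zero = true
allInT S a (suc m) = not (inS S a) ∧ allInT S (suc a) m

-- the interval {a, ..., a+m-1} (mod n) is a maximal interval of c:T, i.e. a
-- connected component of the induced subgraph c:T with m vertices: it lies in T
-- and both neighbours a-1 and a+m lie in S.  (Each component is counted once,
-- by its first vertex a.)
isComponent : {n : ℕ} → Subset n → ℕ → ℕ → Bool
isComponent {n} S a m = inS S (a + n ∸ 1) ∧ allInT S a m ∧ inS S (a + m)

count : {A : Set} → (A → Bool) → List A → ℕ
count p xs = length (filterᵇ p xs)

range : ℕ → List ℕ
range zero = []
range (suc n) = range n ++ (n ∷ [])

numComponents : {n : ℕ} → Subset n → ℕ → ℕ
numComponents {n} S m = count (λ a → isComponent S a m) (range n)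

sumFin : (r : ℕ) → (Fin r → ℕ) → ℕ
sumFin zero f = 0
sumFin (suc r) f = f Fin.zero + sumFin r (λ i → f (Fin.suc i))
  where import Data.Fin as Fin

prodFin : (r : ℕ) → (Fin r → ℕ) → ℕ
prodFin zero f = 1
prodFin (suc r) f = f Fin.zero * prodFin r (λ i → f (Fin.suc i))
  where import Data.Fin as Fin

eqℕ : ℕ → ℕ → Bool
eqℕ zero zero = true
eqℕ zero (suc _) = false
eqℕ (suc _) zero = false
eqℕ (suc a) (suc b) = eqℕ a b

allFinᵇ : (r : ℕ) → (Fin r → Bool) → Bool
allFinᵇ zero p = true
allFinᵇ (suc r) p = p Fin.zero ∧ allFinᵇ r (λ i → p (Fin.suc i))
  where import Data.Fin as Fin

-- Given n, k and j : Fin (n ∸ k) → ℕ with  j i = j_{i+2}  (the multiplicity of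
-- component size i+1), the decomposition S qualifies iff |S| = k and, for every
-- size m = 1..n-k, c:T has exactly j_{m+1} components with m vertices.
goodDecomp : (n k : ℕ) → (Fin (n ∸ k) → ℕ) → Subset n → Bool
goodDecomp n k j S =
  eqℕ ∣ S ∣ k ∧ allFinᵇ (n ∸ k) (λ i → eqℕ (numComponents S (suc (toℕ i))) (j i))

numDecomps : (n k : ℕ) → (Fin (n ∸ k) → ℕ) → ℕ
numDecomps n k j = count (goodDecomp n k j) (allSubsets n)

module Submission where

-- Rotating the cycle preserves the conditions on S, so double counting the pairs (S, x) with
-- x ∈ S gives k · #decompositions = n · #(decompositions with 0 ∈ S).  Cut the cycle at 0 ∈ S
-- and record the gaps: the numbers of vertices of T between cyclically consecutive vertices
-- of S.  The gaps of length m ≥ 1 are exactly the components of c:T of size m, and the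
-- j_1 = k − Σ j remaining gaps have length 0.  So the decompositions with 0 ∈ S correspond to
-- the sequences of k gap lengths with j_1 zeros and j_{m+1} entries m; these are counted by the
-- multinomial coefficient k! / (j_1! ⋯ j_{n−k+1}!), by induction on n splitting off the first gap.

open import Defs
open import Algebra.Bundles using (CommutativeMonoid)
open import Data.Bool using (Bool; true; false; _∧_; not; if_then_else_)
open import Data.Bool.ListAction using (all)
open import Data.Bool.Properties using (∧-zeroʳ; ∧-identityʳ; ∧-assoc; ∧-conicalˡ; ∧-conicalʳ; ⇔→≡; T-≡; ∧-commutativeMonoid)
open import Data.Empty using (⊥-elim)
open import Data.Fin as Fin using (Fin; toℕ)
open import Data.Fin.Properties using (toℕ-fromℕ<)
open import Data.Fin.Subset using (Subset; ∣_∣)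
open import Data.List using (List; []; _∷_; _++_; map; length; replicate)
open import Data.Nat using (ℕ; zero; suc; _+_; _*_; _∸_; _≤_; _<_; _!; z≤n; s≤s; _%_; _/_; _≤ᵇ_; _<ᵇ_)
open import Data.Nat.DivMod using (m≡m%n+[m/n]*n; [m+n]%n≡m%n; m<n⇒m%n≡m; m%n<n)
open import Data.Nat.Induction using (<-rec)
open import Data.Nat.ListAction using (sum)
open import Data.Nat.Properties
open import Data.Sum using (inj₁; inj₂)
open import Data.Vec using ([]; _∷_; lookup; _∷ʳ_; toList)
open import Data.Vec.Properties using (length-toList)
open import Function.Bundles using (mk⇔; Equivalence)
open import Relation.Binary.Definitions using (tri<; tri≈; tri>)
open import Relation.Binary.PropositionalEquality
open import Relation.Nullary using (yes; no)
import Algebra.Properties.CommutativeSemigroup +-commutativeSemigroup as +-CS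
import Algebra.Properties.CommutativeSemigroup *-commutativeSemigroup as *-CS
import Algebra.Properties.CommutativeSemigroup (CommutativeMonoid.commutativeSemigroup ∧-commutativeMonoid) as ∧-CS

𝟙 : Bool → ℕ
𝟙 true = 1
𝟙 false = 0

eqℕ⇒≡ : ∀ a b → eqℕ a b ≡ true → a ≡ b
eqℕ⇒≡ zero zero _ = refl
eqℕ⇒≡ (suc a) (suc b) e = cong suc (eqℕ⇒≡ a b e)

eqℕ-refl : ∀ a → eqℕ a a ≡ true
eqℕ-refl zero = refl
eqℕ-refl (suc a) = eqℕ-refl a

≡⇒eqℕ : ∀ {a b} → a ≡ b → eqℕ a b ≡ true
≡⇒eqℕ {a} refl = eqℕ-refl a

≢⇒eqℕ : ∀ a b → a ≢ b → eqℕ a b ≡ false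
≢⇒eqℕ zero zero a≢b = ⊥-elim (a≢b refl)
≢⇒eqℕ zero (suc b) _ = refl
≢⇒eqℕ (suc a) zero _ = refl
≢⇒eqℕ (suc a) (suc b) a≢b = ≢⇒eqℕ a b (λ a≡b → a≢b (cong suc a≡b))

eqℕ-suc : ∀ a b → eqℕ (suc a) b ≡ (0 <ᵇ b) ∧ eqℕ a (b ∸ 1)
eqℕ-suc a zero = refl
eqℕ-suc a (suc b) = refl

≤ᵇ≡true⇒≤ : ∀ {m n} → (m ≤ᵇ n) ≡ true → m ≤ n
≤ᵇ≡true⇒≤ {m} {n} m≤ᵇn = ≤ᵇ⇒≤ m n (Equivalence.from T-≡ m≤ᵇn)

≤⇒≤ᵇ≡true : ∀ {m n} → m ≤ n → (m ≤ᵇ n) ≡ true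
≤⇒≤ᵇ≡true m≤n = Equivalence.to T-≡ (≤⇒≤ᵇ m≤n)

>⇒≤ᵇ≡false : ∀ {m n} → n < m → (m ≤ᵇ n) ≡ false
>⇒≤ᵇ≡false {m} {n} n<m with m ≤ᵇ n in m≤ᵇn
... | false = refl
... | true = ⊥-elim (<⇒≱ n<m (≤ᵇ≡true⇒≤ m≤ᵇn))

count-∷ : ∀ {A : Set} (p : A → Bool) x xs → count p (x ∷ xs) ≡ 𝟙 (p x) + count p xs
count-∷ p x xs with p x
... | true = refl
... | false = refl

count-++ : ∀ {A : Set} (p : A → Bool) xs ys → count p (xs ++ ys) ≡ count p xs + count p ys
count-++ p [] ys = refl
count-++ p (x ∷ xs) ys = begin
  count p (x ∷ xs ++ ys)                 ≡⟨ count-∷ p x (xs ++ ys) ⟩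
  𝟙 (p x) + count p (xs ++ ys)           ≡⟨ cong (𝟙 (p x) +_) (count-++ p xs ys) ⟩
  𝟙 (p x) + (count p xs + count p ys)    ≡⟨ +-assoc (𝟙 (p x)) _ _ ⟨
  𝟙 (p x) + count p xs + count p ys      ≡⟨ cong (_+ count p ys) (count-∷ p x xs) ⟨
  count p (x ∷ xs) + count p ys          ∎
  where open ≡-Reasoning

count-map : ∀ {A B : Set} (p : B → Bool) (f : A → B) xs → count p (map f xs) ≡ count (λ x → p (f x)) xs
count-map p f [] = refl
count-map p f (x ∷ xs) = begin
  count p (f x ∷ map f xs)               ≡⟨ count-∷ p (f x) (map f xs) ⟩
  𝟙 (p (f x)) + count p (map f xs)       ≡⟨ cong (𝟙 (p (f x)) +_) (count-map p f xs) ⟩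
  𝟙 (p (f x)) + count (λ x → p (f x)) xs ≡⟨ count-∷ (λ x → p (f x)) x xs ⟨
  count (λ x → p (f x)) (x ∷ xs)         ∎
  where open ≡-Reasoning

count-cong : ∀ {A : Set} {p q : A → Bool} xs → (∀ x → p x ≡ q x) → count p xs ≡ count q xs
count-cong [] e = refl
count-cong {p = p} {q} (x ∷ xs) e = begin
  count p (x ∷ xs)         ≡⟨ count-∷ p x xs ⟩
  𝟙 (p x) + count p xs     ≡⟨ cong₂ _+_ (cong 𝟙 (e x)) (count-cong xs e) ⟩
  𝟙 (q x) + count q xs     ≡⟨ count-∷ q x xs ⟨
  count q (x ∷ xs)         ∎
  where open ≡-Reasoning

count-false : ∀ {A : Set} (xs : List A) → count (λ _ → false) xs ≡ 0
count-false [] = refl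
count-false (x ∷ xs) = count-false xs

ΣSubset : (n : ℕ) → (Subset n → ℕ) → ℕ
ΣSubset zero f = f []
ΣSubset (suc n) f = ΣSubset n (λ v → f (true ∷ v)) + ΣSubset n (λ v → f (false ∷ v))

count-allSubsets : ∀ n (p : Subset n → Bool) → count p (allSubsets n) ≡ ΣSubset n (λ S → 𝟙 (p S))
count-allSubsets zero p = trans (count-∷ p [] []) (+-identityʳ _)
count-allSubsets (suc n) p = begin
  count p (map (true ∷_) (allSubsets n) ++ map (false ∷_) (allSubsets n))
    ≡⟨ count-++ p (map (true ∷_) (allSubsets n)) _ ⟩
  count p (map (true ∷_) (allSubsets n)) + count p (map (false ∷_) (allSubsets n))
    ≡⟨ cong₂ _+_ (count-map p (true ∷_) (allSubsets n)) (count-map p (false ∷_) (allSubsets n)) ⟩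
  count (λ v → p (true ∷ v)) (allSubsets n) + count (λ v → p (false ∷ v)) (allSubsets n)
    ≡⟨ cong₂ _+_ (count-allSubsets n _) (count-allSubsets n _) ⟩
  ΣSubset (suc n) (λ S → 𝟙 (p S)) ∎
  where open ≡-Reasoning

ΣSubset-cong : ∀ n {f g : Subset n → ℕ} → (∀ S → f S ≡ g S) → ΣSubset n f ≡ ΣSubset n g
ΣSubset-cong zero e = e []
ΣSubset-cong (suc n) e = cong₂ _+_ (ΣSubset-cong n (λ v → e (true ∷ v))) (ΣSubset-cong n (λ v → e (false ∷ v)))

ΣSubset-0 : ∀ n → ΣSubset n (λ _ → 0) ≡ 0
ΣSubset-0 zero = refl
ΣSubset-0 (suc n) = cong₂ _+_ (ΣSubset-0 n) (ΣSubset-0 n)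

ΣSubset-+ : ∀ n (f g : Subset n → ℕ) → ΣSubset n (λ S → f S + g S) ≡ ΣSubset n f + ΣSubset n g
ΣSubset-+ zero f g = refl
ΣSubset-+ (suc n) f g = begin
  ΣSubset n (λ v → f (true ∷ v) + g (true ∷ v)) + ΣSubset n (λ v → f (false ∷ v) + g (false ∷ v))
    ≡⟨ cong₂ _+_ (ΣSubset-+ n _ _) (ΣSubset-+ n _ _) ⟩
  (a + b) + (c + d) ≡⟨ +-CS.interchange a b c d ⟩
  (a + c) + (b + d) ∎
  where
  open ≡-Reasoning
  a b c d : ℕ
  a = ΣSubset n (λ v → f (true ∷ v))
  b = ΣSubset n (λ v → g (true ∷ v))
  c = ΣSubset n (λ v → f (false ∷ v))
  d = ΣSubset n (λ v → g (false ∷ v))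

ΣSubset-* : ∀ n c (f : Subset n → ℕ) → ΣSubset n (λ S → c * f S) ≡ c * ΣSubset n f
ΣSubset-* zero c f = refl
ΣSubset-* (suc n) c f =
  trans (cong₂ _+_ (ΣSubset-* n c _) (ΣSubset-* n c _)) (sym (*-distribˡ-+ c _ _))

ΣSubset-∷ʳ : ∀ n (f : Subset (suc n) → ℕ) → ΣSubset (suc n) f ≡ ΣSubset n (λ v → f (v ∷ʳ true) + f (v ∷ʳ false))
ΣSubset-∷ʳ zero f = refl
ΣSubset-∷ʳ (suc n) f = cong₂ _+_ (ΣSubset-∷ʳ n (λ v → f (true ∷ v))) (ΣSubset-∷ʳ n (λ v → f (false ∷ v)))

rotate : ∀ {n} → Subset (suc n) → Subset (suc n)
rotate (b ∷ v) = v ∷ʳ b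

ΣSubset-rotate : ∀ n (f : Subset (suc n) → ℕ) → ΣSubset (suc n) (λ S → f (rotate S)) ≡ ΣSubset (suc n) f
ΣSubset-rotate n f = trans (sym (ΣSubset-+ n (λ v → f (v ∷ʳ true)) _)) (sym (ΣSubset-∷ʳ n f))

count-range-suc : ∀ (p : ℕ → Bool) n → count p (range (suc n)) ≡ count p (range n) + 𝟙 (p n)
count-range-suc p n =
  trans (count-++ p (range n) (n ∷ [])) (cong (count p (range n) +_) (trans (count-∷ p n []) (+-identityʳ (𝟙 (p n)))))

count-range-sucˡ : ∀ (p : ℕ → Bool) n → count p (range (suc n)) ≡ 𝟙 (p 0) + count (λ x → p (suc x)) (range n)
count-range-sucˡ p zero = count-∷ p 0 []
count-range-sucˡ p (suc n) = begin
  count p (range (suc (suc n)))                                      ≡⟨ count-range-suc p (suc n) ⟩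
  count p (range (suc n)) + 𝟙 (p (suc n))                            ≡⟨ cong (_+ 𝟙 (p (suc n))) (count-range-sucˡ p n) ⟩
  𝟙 (p 0) + count (λ x → p (suc x)) (range n) + 𝟙 (p (suc n))        ≡⟨ +-assoc (𝟙 (p 0)) _ _ ⟩
  𝟙 (p 0) + (count (λ x → p (suc x)) (range n) + 𝟙 (p (suc n)))      ≡⟨ cong (𝟙 (p 0) +_) (count-range-suc (λ x → p (suc x)) n) ⟨
  𝟙 (p 0) + count (λ x → p (suc x)) (range (suc n))                  ∎
  where open ≡-Reasoning

count-range-cong : ∀ {p q : ℕ → Bool} n → (∀ x → x < n → p x ≡ q x) → count p (range n) ≡ count q (range n)
count-range-cong zero e = refl
count-range-cong {p} {q} (suc n) e = begin
  count p (range (suc n))           ≡⟨ count-range-suc p n ⟩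
  count p (range n) + 𝟙 (p n)       ≡⟨ cong₂ _+_ (count-range-cong n (λ x x<n → e x (m<n⇒m<1+n x<n))) (cong 𝟙 (e n ≤-refl)) ⟩
  count q (range n) + 𝟙 (q n)       ≡⟨ count-range-suc q n ⟨
  count q (range (suc n))           ∎
  where open ≡-Reasoning

count-range-+ : ∀ (p : ℕ → Bool) m n → count p (range (m + n)) ≡ count p (range m) + count (λ x → p (m + x)) (range n)
count-range-+ p m zero = trans (cong (λ l → count p (range l)) (+-identityʳ m)) (sym (+-identityʳ _))
count-range-+ p m (suc n) = begin
  count p (range (m + suc n))                                            ≡⟨ cong (λ l → count p (range l)) (+-suc m n) ⟩
  count p (range (suc (m + n)))                                          ≡⟨ count-range-suc p (m + n) ⟩
  count p (range (m + n)) + 𝟙 (p (m + n))                                ≡⟨ cong (_+ 𝟙 (p (m + n))) (count-range-+ p m n) ⟩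
  count p (range m) + count (λ x → p (m + x)) (range n) + 𝟙 (p (m + n))  ≡⟨ +-assoc (count p (range m)) _ _ ⟩
  count p (range m) + (count (λ x → p (m + x)) (range n) + 𝟙 (p (m + n))) ≡⟨ cong (count p (range m) +_) (count-range-suc (λ x → p (m + x)) n) ⟨
  count p (range m) + count (λ x → p (m + x)) (range (suc n))            ∎
  where open ≡-Reasoning

count-range-shift : ∀ (p : ℕ → Bool) n → p n ≡ p 0 → count (λ x → p (suc x)) (range n) ≡ count p (range n)
count-range-shift p n pn≡p0 = +-cancelˡ-≡ (𝟙 (p 0)) _ _ (begin
  𝟙 (p 0) + count (λ x → p (suc x)) (range n) ≡⟨ count-range-sucˡ p n ⟨
  count p (range (suc n))                     ≡⟨ count-range-suc p n ⟩
  count p (range n) + 𝟙 (p n)                 ≡⟨ cong (λ b → count p (range n) + 𝟙 b) pn≡p0 ⟩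
  count p (range n) + 𝟙 (p 0)                 ≡⟨ +-comm _ (𝟙 (p 0)) ⟩
  𝟙 (p 0) + count p (range n)                 ∎)
  where open ≡-Reasoning

ΣSubset-count-range : ∀ n (p : Subset n → ℕ → Bool) m b → (∀ x → x < m → ΣSubset n (λ S → 𝟙 (p S x)) ≡ b)
  → ΣSubset n (λ S → count (p S) (range m)) ≡ m * b
ΣSubset-count-range n p zero b e = ΣSubset-0 n
ΣSubset-count-range n p (suc m) b e = begin
  ΣSubset n (λ S → count (p S) (range (suc m)))
    ≡⟨ ΣSubset-cong n (λ S → count-range-suc (p S) m) ⟩
  ΣSubset n (λ S → count (p S) (range m) + 𝟙 (p S m))
    ≡⟨ ΣSubset-+ n _ _ ⟩
  ΣSubset n (λ S → count (p S) (range m)) + ΣSubset n (λ S → 𝟙 (p S m))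
    ≡⟨ cong₂ _+_ (ΣSubset-count-range n p m b (λ x x<m → e x (m<n⇒m<1+n x<m))) (e m ≤-refl) ⟩
  m * b + b
    ≡⟨ +-comm (m * b) b ⟩
  suc m * b ∎
  where open ≡-Reasoning

-- Rotating the cycle

lookupℕ : ∀ {n} → Subset n → ℕ → Bool
lookupℕ [] _ = false
lookupℕ (b ∷ v) zero = b
lookupℕ (b ∷ v) (suc x) = lookupℕ v x

lookup≡lookupℕ : ∀ {n} (v : Subset n) (i : Fin n) → lookup v i ≡ lookupℕ v (toℕ i)
lookup≡lookupℕ (b ∷ v) Fin.zero = refl
lookup≡lookupℕ (b ∷ v) (Fin.suc i) = lookup≡lookupℕ v i

lookupℕ-∷ʳ-< : ∀ {n} (v : Subset n) b x → x < n → lookupℕ (v ∷ʳ b) x ≡ lookupℕ v x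
lookupℕ-∷ʳ-< (c ∷ v) b zero _ = refl
lookupℕ-∷ʳ-< (c ∷ v) b (suc x) (s≤s x<n) = lookupℕ-∷ʳ-< v b x x<n

lookupℕ-∷ʳ-last : ∀ {n} (v : Subset n) b → lookupℕ (v ∷ʳ b) n ≡ b
lookupℕ-∷ʳ-last [] b = refl
lookupℕ-∷ʳ-last (c ∷ v) b = lookupℕ-∷ʳ-last v b

inS≡lookupℕ-% : ∀ {n} (S : Subset (suc n)) x → inS S x ≡ lookupℕ S (x % suc n)
inS≡lookupℕ-% {n} S x = trans (lookup≡lookupℕ S _) (cong (lookupℕ S) (toℕ-fromℕ< (m%n<n x (suc n))))

inS-< : ∀ {n} (S : Subset (suc n)) x → x < suc n → inS S x ≡ lookupℕ S x
inS-< {n} S x x<n = trans (inS≡lookupℕ-% S x) (cong (lookupℕ S) (m<n⇒m%n≡m x<n))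

Periodic : {A : Set} → ℕ → (ℕ → A) → Set
Periodic n f = ∀ x → f (x + n) ≡ f x

inS-periodic : ∀ {n} (S : Subset (suc n)) → Periodic (suc n) (inS S)
inS-periodic {n} S x = begin
  inS S (x + suc n)                  ≡⟨ inS≡lookupℕ-% S (x + suc n) ⟩
  lookupℕ S ((x + suc n) % suc n)    ≡⟨ cong (lookupℕ S) ([m+n]%n≡m%n x (suc n)) ⟩
  lookupℕ S (x % suc n)              ≡⟨ inS≡lookupℕ-% S x ⟨
  inS S x                            ∎
  where open ≡-Reasoning

periodic-* : ∀ {A : Set} {n} {f : ℕ → A} → Periodic n f → ∀ q x → f (x + q * n) ≡ f x
periodic-* {n = n} {f} per zero x = cong f (+-identityʳ x)
periodic-* {n = n} {f} per (suc q) x = begin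
  f (x + (n + q * n))   ≡⟨ cong f (trans (cong (x +_) (+-comm n (q * n))) (sym (+-assoc x (q * n) n))) ⟩
  f (x + q * n + n)     ≡⟨ per (x + q * n) ⟩
  f (x + q * n)         ≡⟨ periodic-* per q x ⟩
  f x                   ∎
  where open ≡-Reasoning

periodic-ext : ∀ {A : Set} n {f g : ℕ → A} → Periodic (suc n) f → Periodic (suc n) g
  → (∀ x → x < suc n → f x ≡ g x) → ∀ x → f x ≡ g x
periodic-ext n {f} {g} f-per g-per f≡g x = begin
  f x                                    ≡⟨ cong f (m≡m%n+[m/n]*n x (suc n)) ⟩
  f (x % suc n + (x / suc n) * suc n)    ≡⟨ periodic-* f-per (x / suc n) (x % suc n) ⟩
  f (x % suc n)                          ≡⟨ f≡g (x % suc n) (m%n<n x (suc n)) ⟩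
  g (x % suc n)                          ≡⟨ periodic-* g-per (x / suc n) (x % suc n) ⟨
  g (x % suc n + (x / suc n) * suc n)    ≡⟨ cong g (m≡m%n+[m/n]*n x (suc n)) ⟨
  g x                                    ∎
  where open ≡-Reasoning

inS-rotate : ∀ {n} (S : Subset (suc n)) x → inS (rotate S) x ≡ inS S (suc x)
inS-rotate {n} (b ∷ v) = periodic-ext n (inS-periodic (v ∷ʳ b)) (λ x → inS-periodic (b ∷ v) (suc x)) agree
  where
  agree : ∀ x → x < suc n → inS (v ∷ʳ b) x ≡ inS (b ∷ v) (suc x)
  agree x x<1+n with <-cmp x n
  ... | tri< x<n _ _ = begin
    inS (v ∷ʳ b) x        ≡⟨ inS-< (v ∷ʳ b) x x<1+n ⟩
    lookupℕ (v ∷ʳ b) x    ≡⟨ lookupℕ-∷ʳ-< v b x x<n ⟩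
    lookupℕ v x           ≡⟨ inS-< (b ∷ v) (suc x) (s≤s x<n) ⟨
    inS (b ∷ v) (suc x)   ∎
    where open ≡-Reasoning
  ... | tri≈ _ refl _ = begin
    inS (v ∷ʳ b) n        ≡⟨ inS-< (v ∷ʳ b) n x<1+n ⟩
    lookupℕ (v ∷ʳ b) n    ≡⟨ lookupℕ-∷ʳ-last v b ⟩
    b                     ≡⟨ inS-< (b ∷ v) 0 (s≤s z≤n) ⟨
    inS (b ∷ v) 0         ≡⟨ inS-periodic (b ∷ v) 0 ⟨
    inS (b ∷ v) (suc n)   ∎
    where open ≡-Reasoning
  ... | tri> _ _ n<x = ⊥-elim (<⇒≱ n<x (≤-pred x<1+n))

allFalse : (ℕ → Bool) → ℕ → ℕ → Bool
allFalse f a zero = true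
allFalse f a (suc m) = not (f a) ∧ allFalse f (suc a) m

allInT≡allFalse : ∀ {n} (S : Subset n) a m → allInT S a m ≡ allFalse (inS S) a m
allInT≡allFalse S a zero = refl
allInT≡allFalse S a (suc m) = cong (not (inS S a) ∧_) (allInT≡allFalse S (suc a) m)

allFalse-cong : ∀ {f g : ℕ → Bool} a m → (∀ x → a ≤ x → x < a + m → f x ≡ g x) → allFalse f a m ≡ allFalse g a m
allFalse-cong a zero e = refl
allFalse-cong a (suc m) e rewrite +-suc a m =
  cong₂ _∧_ (cong not (e a ≤-refl (s≤s (m≤m+n a m))))
            (allFalse-cong (suc a) m (λ x a<x x<a+m → e x (<⇒≤ a<x) x<a+m))

allFalse-shift : ∀ (f : ℕ → Bool) c a m → allFalse (λ x → f (c + x)) a m ≡ allFalse f (c + a) m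
allFalse-shift f c a zero = refl
allFalse-shift f c a (suc m) =
  cong (not (f (c + a)) ∧_) (trans (allFalse-shift f c (suc a) m) (cong (λ b → allFalse f b m) (+-suc c a)))

allFalse-periodic : ∀ {n} {f : ℕ → Bool} → Periodic n f → ∀ a m → allFalse f (a + n) m ≡ allFalse f a m
allFalse-periodic per a zero = refl
allFalse-periodic per a (suc m) = cong₂ _∧_ (cong not (per a)) (allFalse-periodic per (suc a) m)

allFalse≡false : ∀ (f : ℕ → Bool) a m x → a ≤ x → x < a + m → f x ≡ true → allFalse f a m ≡ false
allFalse≡false f a zero x a≤x x<a+0 _ = ⊥-elim (<⇒≱ (subst (x <_) (+-identityʳ a) x<a+0) a≤x)
allFalse≡false f a (suc m) x a≤x x<a+1+m fx with m≤n⇒m<n∨m≡n a≤x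
... | inj₂ refl rewrite fx = refl
... | inj₁ a<x = trans (cong (not (f a) ∧_) (allFalse≡false f (suc a) m x a<x (subst (x <_) (+-suc a m) x<a+1+m) fx)) (∧-zeroʳ _)

isComponentOf : (ℕ → Bool) → ℕ → ℕ → ℕ → Bool
isComponentOf f n a m = f (a + n ∸ 1) ∧ allFalse f a m ∧ f (a + m)

numComponents≡count-isComponentOf : ∀ {n} (S : Subset n) m
  → numComponents S m ≡ count (λ a → isComponentOf (inS S) n a m) (range n)
numComponents≡count-isComponentOf {n} S m = count-cong (range n)
  (λ a → cong (λ b → inS S (a + n ∸ 1) ∧ b ∧ inS S (a + m)) (allInT≡allFalse S a m))

isComponentOf-suc : ∀ (f : ℕ → Bool) n a m
  → isComponentOf (λ x → f (suc x)) (suc n) a m ≡ isComponentOf f (suc n) (suc a) m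
isComponentOf-suc f n a m = cong₂ _∧_ (cong f left) (cong (_∧ f (suc a + m)) (allFalse-shift f 1 a m))
  where
  left : suc (a + suc n ∸ 1) ≡ suc a + suc n ∸ 1
  left = trans (cong (λ x → suc (x ∸ 1)) (+-suc a n)) (sym (+-suc a n))

isComponentOf-periodic : ∀ {n} {f : ℕ → Bool} → Periodic (suc n) f
  → ∀ m → isComponentOf f (suc n) (suc n) m ≡ isComponentOf f (suc n) 0 m
isComponentOf-periodic {n} {f} per m =
  cong₂ _∧_ (per n) (cong₂ _∧_ (allFalse-periodic per 0 m) (trans (cong f (+-comm (suc n) m)) (per m)))

isComponentOf-cong : ∀ {f g : ℕ → Bool} n a m → (∀ x → f x ≡ g x) → isComponentOf f n a m ≡ isComponentOf g n a m
isComponentOf-cong n a m f≡g =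
  cong₂ _∧_ (f≡g (a + n ∸ 1)) (cong₂ _∧_ (allFalse-cong a m (λ x _ _ → f≡g x)) (f≡g (a + m)))

numComponents-rotate : ∀ {n} (S : Subset (suc n)) m → numComponents (rotate S) m ≡ numComponents S m
numComponents-rotate {n} S m = begin
  numComponents (rotate S) m
    ≡⟨ numComponents≡count-isComponentOf (rotate S) m ⟩
  count (λ a → isComponentOf (inS (rotate S)) (suc n) a m) (range (suc n))
    ≡⟨ count-cong (range (suc n)) (λ a → trans (isComponentOf-cong (suc n) a m (inS-rotate S)) (isComponentOf-suc (inS S) n a m)) ⟩
  count (λ a → isComponentOf (inS S) (suc n) (suc a) m) (range (suc n))
    ≡⟨ count-range-shift (λ a → isComponentOf (inS S) (suc n) a m) (suc n) (isComponentOf-periodic (inS-periodic S) m) ⟩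
  count (λ a → isComponentOf (inS S) (suc n) a m) (range (suc n))
    ≡⟨ numComponents≡count-isComponentOf S m ⟨
  numComponents S m ∎
  where open ≡-Reasoning

∣∷∣ : ∀ {n} b (v : Subset n) → ∣ b ∷ v ∣ ≡ 𝟙 b + ∣ v ∣
∣∷∣ true v = refl
∣∷∣ false v = refl

∣∷ʳ∣ : ∀ {n} (v : Subset n) b → ∣ v ∷ʳ b ∣ ≡ 𝟙 b + ∣ v ∣
∣∷ʳ∣ [] b = ∣∷∣ b []
∣∷ʳ∣ (c ∷ v) b = begin
  ∣ c ∷ (v ∷ʳ b) ∣          ≡⟨ ∣∷∣ c (v ∷ʳ b) ⟩
  𝟙 c + ∣ v ∷ʳ b ∣          ≡⟨ cong (𝟙 c +_) (∣∷ʳ∣ v b) ⟩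
  𝟙 c + (𝟙 b + ∣ v ∣)       ≡⟨ +-CS.x∙yz≈y∙xz (𝟙 c) (𝟙 b) ∣ v ∣ ⟩
  𝟙 b + (𝟙 c + ∣ v ∣)       ≡⟨ cong (𝟙 b +_) (∣∷∣ c v) ⟨
  𝟙 b + ∣ c ∷ v ∣           ∎
  where open ≡-Reasoning

∣rotate∣ : ∀ {n} (S : Subset (suc n)) → ∣ rotate S ∣ ≡ ∣ S ∣
∣rotate∣ (b ∷ v) = trans (∣∷ʳ∣ v b) (sym (∣∷∣ b v))

count-range-lookupℕ : ∀ {n} (v : Subset n) → count (lookupℕ v) (range n) ≡ ∣ v ∣
count-range-lookupℕ [] = refl
count-range-lookupℕ {suc n} (b ∷ v) =
  trans (count-range-sucˡ (lookupℕ (b ∷ v)) n) (trans (cong (𝟙 b +_) (count-range-lookupℕ v)) (sym (∣∷∣ b v)))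

count-range-inS : ∀ {n} (S : Subset (suc n)) → count (inS S) (range (suc n)) ≡ ∣ S ∣
count-range-inS {n} S = trans (count-range-cong (suc n) (inS-< S)) (count-range-lookupℕ S)

allFinᵇ-cong : ∀ r {p q : Fin r → Bool} → (∀ i → p i ≡ q i) → allFinᵇ r p ≡ allFinᵇ r q
allFinᵇ-cong zero e = refl
allFinᵇ-cong (suc r) e = cong₂ _∧_ (e Fin.zero) (allFinᵇ-cong r (λ i → e (Fin.suc i)))

goodDecomp-rotate : ∀ n k j (S : Subset (suc n)) → goodDecomp (suc n) k j (rotate S) ≡ goodDecomp (suc n) k j S
goodDecomp-rotate n k j S = cong₂ _∧_ (cong (λ s → eqℕ s k) (∣rotate∣ S))
  (allFinᵇ-cong (suc n ∸ k) (λ i → cong (λ c → eqℕ c (j i)) (numComponents-rotate S (suc (toℕ i)))))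

ΣSubset-through-vertex : ∀ {n} (p : Subset (suc n) → Bool) → (∀ S → p (rotate S) ≡ p S)
  → ∀ x → ΣSubset (suc n) (λ S → 𝟙 (p S ∧ inS S x)) ≡ ΣSubset n (λ v → 𝟙 (p (true ∷ v)))
ΣSubset-through-vertex {n} p p-rotate zero = begin
  ΣSubset n (λ v → 𝟙 (p (true ∷ v) ∧ inS (true ∷ v) 0)) + ΣSubset n (λ v → 𝟙 (p (false ∷ v) ∧ inS (false ∷ v) 0))
    ≡⟨ cong₂ _+_ (ΣSubset-cong n (λ v → cong (λ b → 𝟙 (p (true ∷ v) ∧ b)) (inS-< (true ∷ v) 0 (s≤s z≤n))))
                 (ΣSubset-cong n (λ v → cong (λ b → 𝟙 (p (false ∷ v) ∧ b)) (inS-< (false ∷ v) 0 (s≤s z≤n)))) ⟩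
  ΣSubset n (λ v → 𝟙 (p (true ∷ v) ∧ true)) + ΣSubset n (λ v → 𝟙 (p (false ∷ v) ∧ false))
    ≡⟨ cong₂ _+_ (ΣSubset-cong n (λ v → cong 𝟙 (∧-identityʳ _))) (trans (ΣSubset-cong n (λ v → cong 𝟙 (∧-zeroʳ _))) (ΣSubset-0 n)) ⟩
  ΣSubset n (λ v → 𝟙 (p (true ∷ v))) + 0
    ≡⟨ +-identityʳ _ ⟩
  ΣSubset n (λ v → 𝟙 (p (true ∷ v))) ∎
  where open ≡-Reasoning
ΣSubset-through-vertex {n} p p-rotate (suc x) = begin
  ΣSubset (suc n) (λ S → 𝟙 (p S ∧ inS S (suc x)))
    ≡⟨ ΣSubset-cong (suc n) (λ S → cong 𝟙 (sym (cong₂ _∧_ (p-rotate S) (inS-rotate S x)))) ⟩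
  ΣSubset (suc n) (λ S → 𝟙 (p (rotate S) ∧ inS (rotate S) x))
    ≡⟨ ΣSubset-rotate n (λ S → 𝟙 (p S ∧ inS S x)) ⟩
  ΣSubset (suc n) (λ S → 𝟙 (p S ∧ inS S x))
    ≡⟨ ΣSubset-through-vertex p p-rotate x ⟩
  ΣSubset n (λ v → 𝟙 (p (true ∷ v))) ∎
  where open ≡-Reasoning

rotation-double-count : ∀ {n} k (p : Subset (suc n) → Bool) → (∀ S → p (rotate S) ≡ p S)
  → (∀ S → p S ≡ true → ∣ S ∣ ≡ k)
  → k * count p (allSubsets (suc n)) ≡ suc n * ΣSubset n (λ v → 𝟙 (p (true ∷ v)))
rotation-double-count {n} k p p-rotate p⇒∣S∣≡k = begin
  k * count p (allSubsets (suc n))                              ≡⟨ cong (k *_) (count-allSubsets (suc n) p) ⟩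
  k * ΣSubset (suc n) (λ S → 𝟙 (p S))                           ≡⟨ ΣSubset-* (suc n) k (λ S → 𝟙 (p S)) ⟨
  ΣSubset (suc n) (λ S → k * 𝟙 (p S))                           ≡⟨ ΣSubset-cong (suc n) vertices-of-S ⟩
  ΣSubset (suc n) (λ S → count (λ x → p S ∧ inS S x) (range (suc n)))
    ≡⟨ ΣSubset-count-range (suc n) (λ S x → p S ∧ inS S x) (suc n) (ΣSubset n (λ v → 𝟙 (p (true ∷ v))))
                           (λ x _ → ΣSubset-through-vertex p p-rotate x) ⟩
  suc n * ΣSubset n (λ v → 𝟙 (p (true ∷ v)))                    ∎
  where
  open ≡-Reasoning
  vertices-of-S : ∀ S → k * 𝟙 (p S) ≡ count (λ x → p S ∧ inS S x) (range (suc n))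
  vertices-of-S S with p S in eq
  ... | true = trans (*-identityʳ k) (sym (trans (count-range-inS S) (p⇒∣S∣≡k S eq)))
  ... | false = trans (*-zeroʳ k) (sym (count-false (range (suc n))))

-- Cutting the cycle at a vertex of S

-- Reads past the end as true: the vertex after the word true ∷ w is 0 ∈ S again.
lookupᵗ : List Bool → ℕ → Bool
lookupᵗ [] x = true
lookupᵗ (b ∷ l) zero = b
lookupᵗ (b ∷ l) (suc x) = lookupᵗ l x

-- The lengths of the maximal runs of false, the first one lengthened by g.  For S = true ∷ w,
-- gaps w lists the numbers of vertices of T between cyclically consecutive vertices of S.
gapsFrom : ℕ → List Bool → List ℕ
gapsFrom g [] = g ∷ []
gapsFrom g (false ∷ l) = gapsFrom (suc g) l
gapsFrom g (true ∷ l) = g ∷ gapsFrom 0 l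

gaps : ∀ {n} → Subset n → List ℕ
gaps w = gapsFrom 0 (toList w)

multiplicity : ℕ → List ℕ → ℕ
multiplicity m l = count (eqℕ m) l

multiplicity-∷ : ∀ m x l → multiplicity m (x ∷ l) ≡ 𝟙 (eqℕ m x) + multiplicity m l
multiplicity-∷ m x l = count-∷ (eqℕ m) x l

componentAfter : (ℕ → Bool) → ℕ → ℕ → Bool
componentAfter f m a = f a ∧ allFalse f (suc a) m ∧ f (suc a + m)

componentAfter-shift : ∀ {f f' : ℕ → Bool} c m → (∀ x → f (c + x) ≡ f' x)
  → ∀ x → componentAfter f m (c + x) ≡ componentAfter f' m x
componentAfter-shift {f} {f'} c m e x = cong₂ _∧_ (e x) (cong₂ _∧_ inside right)
  where
  inside : allFalse f (suc (c + x)) m ≡ allFalse f' (suc x) m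
  inside = trans (cong (λ a → allFalse f a m) (sym (+-suc c x)))
                 (trans (sym (allFalse-shift f c (suc x) m)) (allFalse-cong (suc x) m (λ y _ _ → e y)))
  right : f (suc (c + x) + m) ≡ f' (suc x + m)
  right = trans (cong f (trans (cong (_+ m) (sym (+-suc c x))) (+-assoc c (suc x) m))) (e (suc x + m))

run-length : ∀ (f : ℕ → Bool) g m → (∀ x → x < g → f (suc x) ≡ false) → f (suc g) ≡ true
  → allFalse f 1 m ∧ f (suc m) ≡ eqℕ m g
run-length f zero zero _ fg = fg
run-length f (suc g) zero f< _ = f< 0 (s≤s z≤n)
run-length f zero (suc m) _ fg rewrite fg = refl
run-length f (suc g) (suc m) f< fg rewrite f< 0 (s≤s z≤n) =
  trans (cong (_∧ f (suc (suc m))) (sym (allFalse-shift f 1 1 m)))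
        (run-length (λ x → f (suc x)) g m (λ x x<g → f< (suc x) (s≤s x<g)) fg)

count-componentAfter-run : ∀ (f : ℕ → Bool) g m → f 0 ≡ true → (∀ x → x < g → f (suc x) ≡ false) → f (suc g) ≡ true
  → count (componentAfter f m) (range (suc g)) ≡ 𝟙 (eqℕ m g)
count-componentAfter-run f g m f0 f< fg = begin
  count (componentAfter f m) (range (suc g))
    ≡⟨ count-range-sucˡ (componentAfter f m) g ⟩
  𝟙 (componentAfter f m 0) + count (λ a → componentAfter f m (suc a)) (range g)
    ≡⟨ cong₂ _+_ (cong 𝟙 first) rest ⟩
  𝟙 (eqℕ m g) + 0
    ≡⟨ +-identityʳ _ ⟩
  𝟙 (eqℕ m g) ∎
  where
  open ≡-Reasoning
  first : componentAfter f m 0 ≡ eqℕ m g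
  first rewrite f0 = run-length f g m f< fg
  rest : count (λ a → componentAfter f m (suc a)) (range g) ≡ 0
  rest = trans (count-range-cong g (λ a a<g → cong (λ b → b ∧ allFalse f (suc (suc a)) m ∧ f (suc (suc a) + m)) (f< a a<g)))
               (count-false (range g))

replicate-false-∷ : ∀ g (l : List Bool) → replicate g false ++ false ∷ l ≡ replicate (suc g) false ++ l
replicate-false-∷ zero l = refl
replicate-false-∷ (suc g) l = cong (false ∷_) (replicate-false-∷ g l)

lookupᵗ-replicate-+ : ∀ g (l : List Bool) x → lookupᵗ (replicate g false ++ l) (g + x) ≡ lookupᵗ l x
lookupᵗ-replicate-+ zero l x = refl
lookupᵗ-replicate-+ (suc g) l x = lookupᵗ-replicate-+ g l x

lookupᵗ-replicate-< : ∀ g (l : List Bool) x → x < g → lookupᵗ (replicate g false ++ l) x ≡ false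
lookupᵗ-replicate-< (suc g) l zero _ = refl
lookupᵗ-replicate-< (suc g) l (suc x) (s≤s x<g) = lookupᵗ-replicate-< g l x x<g

lookupᵗ-replicate : ∀ g (l : List Bool) → lookupᵗ (replicate g false ++ l) g ≡ lookupᵗ l 0
lookupᵗ-replicate g l = trans (cong (lookupᵗ (replicate g false ++ l)) (sym (+-identityʳ g))) (lookupᵗ-replicate-+ g l 0)

-- Only sizes suc m: a gap of length 0 is not a component.
count-componentAfter≡multiplicity : ∀ m g (l : List Bool)
  → count (componentAfter (lookupᵗ (true ∷ replicate g false ++ l)) (suc m)) (range (g + length l))
    ≡ multiplicity (suc m) (gapsFrom g l)
count-componentAfter≡multiplicity m zero [] = refl
count-componentAfter≡multiplicity m (suc g) [] = begin
  count (componentAfter f (suc m)) (range (suc g + 0))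
    ≡⟨ cong (λ n → count (componentAfter f (suc m)) (range n)) (+-identityʳ (suc g)) ⟩
  count (componentAfter f (suc m)) (range (suc g))
    ≡⟨ +-identityʳ _ ⟨
  count (componentAfter f (suc m)) (range (suc g)) + 𝟙 false
    ≡⟨ cong (λ b → count (componentAfter f (suc m)) (range (suc g)) + 𝟙 (b ∧ allFalse f (suc (suc g)) (suc m) ∧ f (suc (suc g) + suc m)))
            (lookupᵗ-replicate-< (suc g) [] g ≤-refl) ⟨
  count (componentAfter f (suc m)) (range (suc g)) + 𝟙 (componentAfter f (suc m) (suc g))
    ≡⟨ count-range-suc (componentAfter f (suc m)) (suc g) ⟨
  count (componentAfter f (suc m)) (range (suc (suc g)))
    ≡⟨ count-componentAfter-run f (suc g) (suc m) refl (lookupᵗ-replicate-< (suc g) []) (lookupᵗ-replicate (suc g) []) ⟩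
  𝟙 (eqℕ (suc m) (suc g))
    ≡⟨ trans (multiplicity-∷ (suc m) (suc g) []) (+-identityʳ _) ⟨
  multiplicity (suc m) (suc g ∷ []) ∎
  where
  open ≡-Reasoning
  f : ℕ → Bool
  f = lookupᵗ (true ∷ replicate (suc g) false ++ [])
count-componentAfter≡multiplicity m g (false ∷ l) = begin
  count (componentAfter (lookupᵗ (true ∷ replicate g false ++ false ∷ l)) (suc m)) (range (g + suc (length l)))
    ≡⟨ cong₂ (λ w n → count (componentAfter (lookupᵗ (true ∷ w)) (suc m)) (range n)) (replicate-false-∷ g l) (+-suc g (length l)) ⟩
  count (componentAfter (lookupᵗ (true ∷ replicate (suc g) false ++ l)) (suc m)) (range (suc g + length l))
    ≡⟨ count-componentAfter≡multiplicity m (suc g) l ⟩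
  multiplicity (suc m) (gapsFrom (suc g) l) ∎
  where open ≡-Reasoning
count-componentAfter≡multiplicity m g (true ∷ l) = begin
  count (componentAfter f (suc m)) (range (g + suc (length l)))
    ≡⟨ cong (λ n → count (componentAfter f (suc m)) (range n)) (+-suc g (length l)) ⟩
  count (componentAfter f (suc m)) (range (suc g + length l))
    ≡⟨ count-range-+ (componentAfter f (suc m)) (suc g) (length l) ⟩
  count (componentAfter f (suc m)) (range (suc g)) + count (λ x → componentAfter f (suc m) (suc g + x)) (range (length l))
    ≡⟨ cong₂ _+_ (count-componentAfter-run f g (suc m) refl (lookupᵗ-replicate-< g (true ∷ l)) (lookupᵗ-replicate g (true ∷ l)))
                 (count-cong (range (length l)) (componentAfter-shift {f} {lookupᵗ (true ∷ l)} (suc g) (suc m) (lookupᵗ-replicate-+ g (true ∷ l)))) ⟩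
  𝟙 (eqℕ (suc m) g) + count (componentAfter (lookupᵗ (true ∷ l)) (suc m)) (range (length l))
    ≡⟨ cong (𝟙 (eqℕ (suc m) g) +_) (count-componentAfter≡multiplicity m zero l) ⟩
  𝟙 (eqℕ (suc m) g) + multiplicity (suc m) (gapsFrom 0 l)
    ≡⟨ multiplicity-∷ (suc m) g (gapsFrom 0 l) ⟨
  multiplicity (suc m) (g ∷ gapsFrom 0 l) ∎
  where
  open ≡-Reasoning
  f : ℕ → Bool
  f = lookupᵗ (true ∷ replicate g false ++ true ∷ l)

lookupℕ≡lookupᵗ : ∀ {n} (v : Subset n) x → x < n → lookupℕ v x ≡ lookupᵗ (toList v) x
lookupℕ≡lookupᵗ (b ∷ v) zero _ = refl
lookupℕ≡lookupᵗ (b ∷ v) (suc x) (s≤s x<n) = lookupℕ≡lookupᵗ v x x<n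

lookupᵗ-length : ∀ {n} (v : Subset n) → lookupᵗ (toList v) n ≡ true
lookupᵗ-length [] = refl
lookupᵗ-length (b ∷ v) = lookupᵗ-length v

module _ {n : ℕ} (w : Subset n) where
  private
    S : Subset (suc n)
    S = true ∷ w
    word : ℕ → Bool
    word = lookupᵗ (true ∷ toList w)

  inS-true-∷≡word : ∀ x → x ≤ suc n → inS S x ≡ word x
  inS-true-∷≡word x x≤1+n with m≤n⇒m<n∨m≡n x≤1+n
  ... | inj₁ x<1+n = trans (inS-< S x x<1+n) (agree x x<1+n)
    where
    agree : ∀ x → x < suc n → lookupℕ S x ≡ word x
    agree zero _ = refl
    agree (suc x) (s≤s x<n) = lookupℕ≡lookupᵗ w x x<n
  ... | inj₂ refl = trans (inS-periodic S 0) (trans (inS-< S 0 (s≤s z≤n)) (sym (lookupᵗ-length w)))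

  isComponentOf-true-∷ : ∀ m a → a < n → isComponentOf (inS S) (suc n) (suc a) (suc m) ≡ componentAfter word (suc m) a
  isComponentOf-true-∷ m a a<n = cong₂ _∧_ left rest
    where
    a<1+n : a < suc n
    a<1+n = m<n⇒m<1+n a<n
    left : inS S (a + suc n) ≡ word a
    left = trans (inS-periodic S a) (inS-true-∷≡word a (<⇒≤ a<1+n))
    blocked : suc n < suc a + suc m → ∀ f → f (suc n) ≡ true → allFalse f (suc a) (suc m) ≡ false
    blocked overflow f fn = allFalse≡false f (suc a) (suc m) (suc n) a<1+n overflow fn
    rest : allFalse (inS S) (suc a) (suc m) ∧ inS S (suc a + suc m) ≡ allFalse word (suc a) (suc m) ∧ word (suc a + suc m)
    rest with suc a + suc m ≤? suc n
    ... | yes fits = cong₂ _∧_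
      (allFalse-cong (suc a) (suc m) (λ x _ x<end → inS-true-∷≡word x (≤-trans (<⇒≤ x<end) fits)))
      (inS-true-∷≡word (suc a + suc m) fits)
    ... | no overflows = trans (cong (_∧ inS S (suc a + suc m)) (blocked (≰⇒> overflows) (inS S) (trans (inS-periodic S 0) (inS-< S 0 (s≤s z≤n)))))
                               (sym (cong (_∧ word (suc a + suc m)) (blocked (≰⇒> overflows) word (lookupᵗ-length w))))

  numComponents-true-∷ : ∀ m → numComponents S (suc m) ≡ multiplicity (suc m) (gaps w)
  numComponents-true-∷ m = begin
    numComponents S (suc m)
      ≡⟨ numComponents≡count-isComponentOf S (suc m) ⟩
    count (λ a → isComponentOf (inS S) (suc n) a (suc m)) (range (suc n))
      ≡⟨ count-range-sucˡ _ n ⟩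
    𝟙 (isComponentOf (inS S) (suc n) 0 (suc m)) + count (λ a → isComponentOf (inS S) (suc n) (suc a) (suc m)) (range n)
      ≡⟨ cong₂ _+_ (cong 𝟙 no-component-at-0) (count-range-cong n (isComponentOf-true-∷ m)) ⟩
    count (componentAfter word (suc m)) (range n)
      ≡⟨ cong (λ l → count (componentAfter word (suc m)) (range l)) (length-toList w) ⟨
    count (componentAfter word (suc m)) (range (length (toList w)))
      ≡⟨ count-componentAfter≡multiplicity m 0 (toList w) ⟩
    multiplicity (suc m) (gaps w) ∎
    where
    open ≡-Reasoning
    no-component-at-0 : isComponentOf (inS S) (suc n) 0 (suc m) ≡ false
    no-component-at-0 rewrite inS-< S 0 (s≤s z≤n) = ∧-zeroʳ _

-- Gap sequences with a prescribed profile

sum< : ℕ → (ℕ → ℕ) → ℕ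
sum< zero h = 0
sum< (suc M) h = h 0 + sum< M (λ i → h (suc i))

prod< : ℕ → (ℕ → ℕ) → ℕ
prod< zero h = 1
prod< (suc M) h = h 0 * prod< M (λ i → h (suc i))

all< : ℕ → (ℕ → Bool) → Bool
all< zero p = true
all< (suc M) p = p 0 ∧ all< M (λ i → p (suc i))

sum<-cong : ∀ M {h h' : ℕ → ℕ} → (∀ i → i < M → h i ≡ h' i) → sum< M h ≡ sum< M h'
sum<-cong zero e = refl
sum<-cong (suc M) e = cong₂ _+_ (e 0 (s≤s z≤n)) (sum<-cong M (λ i i<M → e (suc i) (s≤s i<M)))

prod<-cong : ∀ M {h h' : ℕ → ℕ} → (∀ i → i < M → h i ≡ h' i) → prod< M h ≡ prod< M h'
prod<-cong zero e = refl
prod<-cong (suc M) e = cong₂ _*_ (e 0 (s≤s z≤n)) (prod<-cong M (λ i i<M → e (suc i) (s≤s i<M)))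

all<-cong : ∀ M {p q : ℕ → Bool} → (∀ i → i < M → p i ≡ q i) → all< M p ≡ all< M q
all<-cong zero e = refl
all<-cong (suc M) e = cong₂ _∧_ (e 0 (s≤s z≤n)) (all<-cong M (λ i i<M → e (suc i) (s≤s i<M)))

sum<-0 : ∀ M {h : ℕ → ℕ} → (∀ i → i < M → h i ≡ 0) → sum< M h ≡ 0
sum<-0 zero e = refl
sum<-0 (suc M) e = cong₂ _+_ (e 0 (s≤s z≤n)) (sum<-0 M (λ i i<M → e (suc i) (s≤s i<M)))

prod<-1 : ∀ M {h : ℕ → ℕ} → (∀ i → i < M → h i ≡ 1) → prod< M h ≡ 1
prod<-1 zero e = refl
prod<-1 (suc M) e = cong₂ _*_ (e 0 (s≤s z≤n)) (prod<-1 M (λ i i<M → e (suc i) (s≤s i<M)))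

sum<-+ : ∀ M (h h' : ℕ → ℕ) → sum< M (λ i → h i + h' i) ≡ sum< M h + sum< M h'
sum<-+ zero h h' = refl
sum<-+ (suc M) h h' = trans (cong (h 0 + h' 0 +_) (sum<-+ M _ _)) (+-CS.interchange (h 0) (h' 0) _ _)

sum<-* : ∀ M a (h : ℕ → ℕ) → sum< M (λ i → a * h i) ≡ a * sum< M h
sum<-* zero a h = sym (*-zeroʳ a)
sum<-* (suc M) a h = trans (cong (a * h 0 +_) (sum<-* M a _)) (sym (*-distribˡ-+ a (h 0) _))

sum<-term : ∀ M (h : ℕ → ℕ) x → x < M → h x ≤ sum< M h
sum<-term (suc M) h zero _ = m≤m+n (h 0) _
sum<-term (suc M) h (suc x) (s≤s x<M) = ≤-trans (sum<-term M _ x x<M) (m≤n+m _ (h 0))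

sum<-support : ∀ B M {h : ℕ → ℕ} → (∀ i → B ≤ i → h i ≡ 0) → B ≤ M → sum< M h ≡ sum< B h
sum<-support zero M h0 _ = sum<-0 M (λ i _ → h0 i z≤n)
sum<-support (suc B) (suc M) {h} h0 (s≤s B≤M) = cong (h 0 +_) (sum<-support B M (λ i B≤i → h0 (suc i) (s≤s B≤i)) B≤M)

sum<-vanishing : ∀ M M' {h : ℕ → ℕ} → (∀ i → M ≤ i → h i ≡ 0) → (∀ i → M' ≤ i → h i ≡ 0) → sum< M h ≡ sum< M' h
sum<-vanishing M M' hM hM' with ≤-total M M'
... | inj₁ M≤M' = sym (sum<-support M M' hM M≤M')
... | inj₂ M'≤M = sum<-support M' M hM' M'≤M

all<⇒ : ∀ M {p : ℕ → Bool} → all< M p ≡ true → ∀ i → i < M → p i ≡ true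
all<⇒ (suc M) {p} e zero _ = ∧-conicalˡ (p 0) _ e
all<⇒ (suc M) {p} e (suc i) (s≤s i<M) = all<⇒ M (∧-conicalʳ (p 0) _ e) i i<M

⇒all< : ∀ M {p : ℕ → Bool} → (∀ i → i < M → p i ≡ true) → all< M p ≡ true
⇒all< zero e = refl
⇒all< (suc M) e = cong₂ _∧_ (e 0 (s≤s z≤n)) (⇒all< M (λ i i<M → e (suc i) (s≤s i<M)))

all<-extract : ∀ M {p q : ℕ → Bool} a x → x < M → (∀ i → i ≢ x → p i ≡ q i) → p x ≡ a ∧ q x
  → all< M p ≡ a ∧ all< M q
all<-extract (suc M) {p} {q} a zero _ elsewhere at-x =
  trans (cong₂ _∧_ at-x (all<-cong M (λ i _ → elsewhere (suc i) (λ ())))) (∧-assoc a (q 0) _)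
all<-extract (suc M) {p} {q} a (suc x) (s≤s x<M) elsewhere at-x =
  trans (cong₂ _∧_ (elsewhere 0 (λ ())) (all<-extract M a x x<M (λ i i≢x → elsewhere (suc i) (λ e → i≢x (suc-injective e))) at-x))
        (∧-CS.x∙yz≈y∙xz (q 0) a _)

decrementAt : ℕ → (ℕ → ℕ) → ℕ → ℕ
decrementAt x h i = if eqℕ i x then h i ∸ 1 else h i

sum<-decrementAt : ∀ M (wt h : ℕ → ℕ) x → x < M → 0 < h x
  → sum< M (λ i → wt i * decrementAt x h i) + wt x ≡ sum< M (λ i → wt i * h i)
sum<-decrementAt (suc M) wt h zero _ 0<hx with h 0 | 0<hx
... | suc y | _ = begin
  wt 0 * y + A + wt 0    ≡⟨ +-CS.xy∙z≈xz∙y (wt 0 * y) A (wt 0) ⟩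
  wt 0 * y + wt 0 + A    ≡⟨ cong (_+ A) (trans (+-comm (wt 0 * y) (wt 0)) (sym (*-suc (wt 0) y))) ⟩
  wt 0 * suc y + A       ∎
  where
  open ≡-Reasoning
  A : ℕ
  A = sum< M (λ i → wt (suc i) * h (suc i))
sum<-decrementAt (suc M) wt h (suc x) (s≤s x<M) 0<hx =
  trans (+-assoc (wt 0 * h 0) _ _) (cong (wt 0 * h 0 +_) (sum<-decrementAt M (λ i → wt (suc i)) (λ i → h (suc i)) x x<M 0<hx))

prod<-!-decrementAt : ∀ M (h : ℕ → ℕ) x → x < M → 0 < h x → prod< M (λ i → h i !) ≡ h x * prod< M (λ i → decrementAt x h i !)
prod<-!-decrementAt (suc M) h zero _ 0<hx with h 0 | 0<hx
... | suc y | _ = *-assoc (suc y) (y !) _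
prod<-!-decrementAt (suc M) h (suc x) (s≤s x<M) 0<hx =
  trans (cong (h 0 ! *_) (prod<-!-decrementAt M (λ i → h (suc i)) x x<M 0<hx)) (*-CS.x∙yz≈y∙xz (h 0 !) (h (suc x)) _)

-- Σgaps n F sums F over the gap sequences of the words true ∷ w of length n, that is, over
-- the lists L with sum L + length L ≡ n, each exactly once.
Σgaps : ℕ → (List ℕ → ℕ) → ℕ
Σgaps zero F = F []
Σgaps (suc n) F = ΣSubset n (λ w → F (gaps w))

Σgaps-cong : ∀ n {F F' : List ℕ → ℕ} → (∀ L → F L ≡ F' L) → Σgaps n F ≡ Σgaps n F'
Σgaps-cong zero e = e []
Σgaps-cong (suc n) e = ΣSubset-cong n (λ w → e (gaps w))

Σgaps-0 : ∀ n {F : List ℕ → ℕ} → (∀ L → F L ≡ 0) → Σgaps n F ≡ 0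
Σgaps-0 zero e = e []
Σgaps-0 (suc n) e = trans (ΣSubset-cong n (λ w → e (gaps w))) (ΣSubset-0 n)

Σgaps-guard : ∀ n b (p : List ℕ → Bool) → Σgaps n (λ L → 𝟙 (b ∧ p L)) ≡ 𝟙 b * Σgaps n (λ L → 𝟙 (p L))
Σgaps-guard n true p = sym (*-identityˡ _)
Σgaps-guard n false p = Σgaps-0 n (λ _ → refl)

ΣSubset-gapsFrom : ∀ n g (F : List ℕ → ℕ)
  → ΣSubset n (λ w → F (gapsFrom g (toList w))) ≡ sum< (suc n) (λ m → Σgaps (n ∸ m) (λ L → F (g + m ∷ L)))
ΣSubset-gapsFrom zero g F = trans (cong (λ x → F (x ∷ [])) (sym (+-identityʳ g))) (sym (+-identityʳ _))
ΣSubset-gapsFrom (suc n) g F = cong₂ _+_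
  (ΣSubset-cong n (λ w → cong (λ x → F (x ∷ gaps w)) (sym (+-identityʳ g))))
  (trans (ΣSubset-gapsFrom n (suc g) F)
         (sum<-cong (suc n) (λ m _ → Σgaps-cong (n ∸ m) (λ L → cong (λ x → F (x ∷ L)) (sym (+-suc g m))))))

Σgaps-first : ∀ n (F : List ℕ → ℕ) → Σgaps (suc n) F ≡ sum< (suc n) (λ m → Σgaps (n ∸ m) (λ L → F (m ∷ L)))
Σgaps-first n F = ΣSubset-gapsFrom n 0 F

pred!*≡! : ∀ {t} → 0 < t → (t ∸ 1) ! * t ≡ t !
pred!*≡! {suc t} _ = *-comm (t !) (suc t)

-- A profile c prescribes c m gaps of length m for m ≤ R.  A gap of length m together with the
-- vertex of S before it occupies m + 1 vertices, hence the weight.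
module Profiles (R : ℕ) where

  total weight factorials : (ℕ → ℕ) → ℕ
  total c = sum< (suc R) c
  weight c = sum< (suc R) (λ i → suc i * c i)
  factorials c = prod< (suc R) (λ i → c i !)

  hasProfile : (ℕ → ℕ) → List ℕ → Bool
  hasProfile c L = all (_≤ᵇ R) L ∧ all< (suc R) (λ m → eqℕ (multiplicity m L) (c m))

  weight-term : ∀ c i → i ≤ R → suc i * c i ≤ weight c
  weight-term c i i≤R = sum<-term (suc R) (λ i → suc i * c i) i (s≤s i≤R)

  weight≡0⇒≡0 : ∀ c → weight c ≡ 0 → ∀ i → i ≤ R → c i ≡ 0
  weight≡0⇒≡0 c w≡0 i i≤R = m+n≡0⇒m≡0 (c i) (n≤0⇒n≡0 (subst (suc i * c i ≤_) w≡0 (weight-term c i i≤R)))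

  weight-beyond : ∀ c n → weight c ≡ n → ∀ i → n ≤ i → i ≤ R → c i ≡ 0
  weight-beyond c n w≡n i n≤i i≤R = n<1⇒n≡0 (*-cancelˡ-< (suc i) (c i) 1 (begin-strict
    suc i * c i   ≤⟨ weight-term c i i≤R ⟩
    weight c      ≡⟨ w≡n ⟩
    n             ≤⟨ n≤i ⟩
    i             <⟨ n<1+n i ⟩
    suc i         ≡⟨ *-identityʳ (suc i) ⟨
    suc i * 1     ∎))
    where open ≤-Reasoning

  hasProfile-∷ : ∀ c x L → hasProfile c (x ∷ L) ≡ ((x ≤ᵇ R) ∧ (0 <ᵇ c x)) ∧ hasProfile (decrementAt x c) L
  hasProfile-∷ c x L with x ≤ᵇ R in x≤ᵇR
  ... | false = refl
  ... | true = trans (cong (all (_≤ᵇ R) L ∧_) counts) (∧-CS.x∙yz≈y∙xz (all (_≤ᵇ R) L) (0 <ᵇ c x) _)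
    where
    x≤R : x ≤ R
    x≤R = ≤ᵇ≡true⇒≤ x≤ᵇR
    other : ∀ m → m ≢ x → eqℕ (multiplicity m (x ∷ L)) (c m) ≡ eqℕ (multiplicity m L) (decrementAt x c m)
    other m m≢x rewrite ≢⇒eqℕ m x m≢x = refl
    self : eqℕ (multiplicity x (x ∷ L)) (c x) ≡ (0 <ᵇ c x) ∧ eqℕ (multiplicity x L) (decrementAt x c x)
    self rewrite eqℕ-refl x = eqℕ-suc (multiplicity x L) (c x)
    counts : all< (suc R) (λ m → eqℕ (multiplicity m (x ∷ L)) (c m))
           ≡ (0 <ᵇ c x) ∧ all< (suc R) (λ m → eqℕ (multiplicity m L) (decrementAt x c m))
    counts = all<-extract (suc R) (0 <ᵇ c x) x (s≤s x≤R) other self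

  hasProfile-[] : ∀ c → hasProfile c [] ≡ eqℕ (weight c) 0
  hasProfile-[] c = ⇔→≡ (mk⇔ vanishing⇒weight≡0 weight≡0⇒vanishing)
    where
    vanishing⇒weight≡0 : all< (suc R) (λ m → eqℕ 0 (c m)) ≡ true → eqℕ (weight c) 0 ≡ true
    vanishing⇒weight≡0 h = ≡⇒eqℕ (sum<-0 (suc R) (λ i i<1+R →
      trans (cong (suc i *_) (sym (eqℕ⇒≡ 0 (c i) (all<⇒ (suc R) {λ m → eqℕ 0 (c m)} h i i<1+R)))) (*-zeroʳ (suc i))))
    weight≡0⇒vanishing : eqℕ (weight c) 0 ≡ true → all< (suc R) (λ m → eqℕ 0 (c m)) ≡ true
    weight≡0⇒vanishing h = ⇒all< (suc R) (λ i i<1+R → ≡⇒eqℕ {0} {c i} (sym (weight≡0⇒≡0 c (eqℕ⇒≡ _ 0 h) i (≤-pred i<1+R))))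

  module _ (c : ℕ → ℕ) (x : ℕ) (x≤R : x ≤ R) (0<cx : 0 < c x) where

    weight-decrementAt : weight (decrementAt x c) + suc x ≡ weight c
    weight-decrementAt = sum<-decrementAt (suc R) suc c x (s≤s x≤R) 0<cx

    total-decrementAt : total (decrementAt x c) ≡ total c ∸ 1
    total-decrementAt = begin
      total (decrementAt x c)
        ≡⟨ m+n∸n≡m _ 1 ⟨
      total (decrementAt x c) + 1 ∸ 1
        ≡⟨ cong (λ t → t + 1 ∸ 1) (sum<-cong (suc R) (λ i _ → *-identityˡ (decrementAt x c i))) ⟨
      sum< (suc R) (λ i → 1 * decrementAt x c i) + 1 ∸ 1
        ≡⟨ cong (_∸ 1) (sum<-decrementAt (suc R) (λ _ → 1) c x (s≤s x≤R) 0<cx) ⟩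
      sum< (suc R) (λ i → 1 * c i) ∸ 1
        ≡⟨ cong (_∸ 1) (sum<-cong (suc R) (λ i _ → *-identityˡ (c i))) ⟩
      total c ∸ 1 ∎
      where open ≡-Reasoning

    factorials-decrementAt : factorials c ≡ c x * factorials (decrementAt x c)
    factorials-decrementAt = prod<-!-decrementAt (suc R) c x (s≤s x≤R) 0<cx

  profiled : (ℕ → ℕ) → List ℕ → ℕ
  profiled c L = 𝟙 (hasProfile c L)

  Multinomial : ℕ → (ℕ → ℕ) → Set
  Multinomial n c = Σgaps n (profiled c) * factorials c ≡ 𝟙 (eqℕ (weight c) n) * total c !

  weight-decrementAt-≡ : ∀ c n m → m ≤ n → m ≤ R → 0 < c m
    → eqℕ (weight (decrementAt m c)) (n ∸ m) ≡ eqℕ (weight c) (suc n)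
  weight-decrementAt-≡ c n m m≤n m≤R 0<cm = ⇔→≡ (mk⇔
    (λ h → ≡⇒eqℕ (begin
      weight c                               ≡⟨ weight-decrementAt c m m≤R 0<cm ⟨
      weight (decrementAt m c) + suc m       ≡⟨ cong (_+ suc m) (eqℕ⇒≡ (weight (decrementAt m c)) (n ∸ m) h) ⟩
      n ∸ m + suc m                          ≡⟨ +-suc (n ∸ m) m ⟩
      suc (n ∸ m + m)                        ≡⟨ cong suc (m∸n+n≡m m≤n) ⟩
      suc n                                  ∎))
    (λ h → ≡⇒eqℕ (begin
      weight (decrementAt m c)               ≡⟨ m+n∸n≡m _ (suc m) ⟨
      weight (decrementAt m c) + suc m ∸ suc m ≡⟨ cong (_∸ suc m) (weight-decrementAt c m m≤R 0<cm) ⟩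
      weight c ∸ suc m                       ≡⟨ cong (_∸ suc m) (eqℕ⇒≡ (weight c) (suc n) h) ⟩
      n ∸ m                                  ∎)))
    where open ≡-Reasoning

  first-gap : ∀ n c m → m ≤ n → Multinomial (n ∸ m) (decrementAt m c)
    → factorials c * Σgaps (n ∸ m) (λ L → profiled c (m ∷ L)) ≡ 𝟙 (eqℕ (weight c) (suc n)) * (total c ∸ 1) ! * (𝟙 (m ≤ᵇ R) * c m)
  first-gap n c m m≤n ih = begin
    factorials c * Σgaps (n ∸ m) (λ L → profiled c (m ∷ L))
      ≡⟨ cong (factorials c *_) (Σgaps-cong (n ∸ m) (λ L → cong 𝟙 (hasProfile-∷ c m L))) ⟩
    factorials c * Σgaps (n ∸ m) (λ L → 𝟙 (((m ≤ᵇ R) ∧ (0 <ᵇ c m)) ∧ hasProfile (decrementAt m c) L))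
      ≡⟨ cong (factorials c *_) (Σgaps-guard (n ∸ m) ((m ≤ᵇ R) ∧ (0 <ᵇ c m)) (hasProfile (decrementAt m c))) ⟩
    factorials c * (𝟙 ((m ≤ᵇ R) ∧ (0 <ᵇ c m)) * Σgaps (n ∸ m) (profiled (decrementAt m c)))
      ≡⟨ guarded ⟩
    X * (𝟙 (m ≤ᵇ R) * c m) ∎
    where
    open ≡-Reasoning
    c′ : ℕ → ℕ
    c′ = decrementAt m c
    X Σ′ : ℕ
    X = 𝟙 (eqℕ (weight c) (suc n)) * (total c ∸ 1) !
    Σ′ = Σgaps (n ∸ m) (profiled c′)
    guarded : factorials c * (𝟙 ((m ≤ᵇ R) ∧ (0 <ᵇ c m)) * Σ′) ≡ X * (𝟙 (m ≤ᵇ R) * c m)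
    guarded with m ≤ᵇ R in m≤ᵇR | c m in cm
    ... | false | _ = trans (*-zeroʳ (factorials c)) (sym (*-zeroʳ X))
    ... | true | zero = trans (*-zeroʳ (factorials c)) (sym (*-zeroʳ X))
    ... | true | suc y = begin
      factorials c * (1 * Σ′)
        ≡⟨ cong₂ _*_ (factorials-decrementAt c m m≤R 0<cm) (*-identityˡ Σ′) ⟩
      c m * factorials c′ * Σ′
        ≡⟨ *-CS.xy∙z≈x∙zy (c m) (factorials c′) Σ′ ⟩
      c m * (Σ′ * factorials c′)
        ≡⟨ cong (c m *_) ih ⟩
      c m * (𝟙 (eqℕ (weight c′) (n ∸ m)) * total c′ !)
        ≡⟨ cong₂ (λ b t → c m * (𝟙 b * t !)) (weight-decrementAt-≡ c n m m≤n m≤R 0<cm) (total-decrementAt c m m≤R 0<cm) ⟩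
      c m * X
        ≡⟨ cong (_* X) cm ⟩
      suc y * X
        ≡⟨ *-comm (suc y) X ⟩
      X * suc y
        ≡⟨ cong (X *_) (*-identityˡ (suc y)) ⟨
      X * (1 * suc y) ∎
      where
      m≤R : m ≤ R
      m≤R = ≤ᵇ≡true⇒≤ m≤ᵇR
      0<cm : 0 < c m
      0<cm = subst (0 <_) (sym cm) (s≤s z≤n)

  weight≡suc⇒total>0 : ∀ c n → weight c ≡ suc n → 0 < total c
  weight≡suc⇒total>0 c n w≡1+n with total c in t
  ... | suc _ = s≤s z≤n
  ... | zero = ⊥-elim (1+n≢0 (trans (sym w≡1+n) (sum<-0 (suc R) (λ i i<1+R →
          trans (cong (suc i *_) (n≤0⇒n≡0 (subst (c i ≤_) t (sum<-term (suc R) c i i<1+R)))) (*-zeroʳ (suc i))))))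

  sum<-gapSizes : ∀ c n → weight c ≡ suc n → sum< (suc n) (λ m → 𝟙 (m ≤ᵇ R) * c m) ≡ total c
  sum<-gapSizes c n w≡1+n = trans
    (sum<-vanishing (suc n) (suc R) beyond-n beyond-R)
    (sum<-cong (suc R) (λ i i<1+R → trans (cong (λ b → 𝟙 b * c i) (≤⇒≤ᵇ≡true (≤-pred i<1+R))) (+-identityʳ (c i))))
    where
    beyond-R : ∀ i → suc R ≤ i → 𝟙 (i ≤ᵇ R) * c i ≡ 0
    beyond-R i R<i = cong (λ b → 𝟙 b * c i) (>⇒≤ᵇ≡false R<i)
    beyond-n : ∀ i → suc n ≤ i → 𝟙 (i ≤ᵇ R) * c i ≡ 0
    beyond-n i n<i with i ≤? R
    ... | yes i≤R = trans (cong (𝟙 (i ≤ᵇ R) *_) (weight-beyond c (suc n) w≡1+n i n<i i≤R)) (*-zeroʳ (𝟙 (i ≤ᵇ R)))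
    ... | no i≰R = beyond-R i (≰⇒> i≰R)

  multinomial-[] : ∀ c → Multinomial 0 c
  multinomial-[] c rewrite hasProfile-[] c with eqℕ (weight c) 0 in w≡ᵇ0
  ... | false = refl
  ... | true = cong (1 *_) (trans (prod<-1 (suc R) (λ i i<1+R → cong _! (vanish i i<1+R)))
                                  (cong _! (sym (sum<-0 (suc R) vanish))))
    where
    vanish : ∀ i → i < suc R → c i ≡ 0
    vanish i i<1+R = weight≡0⇒≡0 c (eqℕ⇒≡ (weight c) 0 w≡ᵇ0) i (≤-pred i<1+R)

  multinomial : ∀ n c → Multinomial n c
  multinomial = <-rec (λ n → ∀ c → Multinomial n c) step
    where
    step : ∀ n → (∀ {m} → m < n → ∀ c → Multinomial m c) → ∀ c → Multinomial n c
    step zero _ c = multinomial-[] c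
    step (suc n) ih c = begin
      Σgaps (suc n) (profiled c) * factorials c
        ≡⟨ trans (cong (_* factorials c) (Σgaps-first n (profiled c))) (*-comm _ (factorials c)) ⟩
      factorials c * sum< (suc n) (λ m → Σgaps (n ∸ m) (λ L → profiled c (m ∷ L)))
        ≡⟨ sum<-* (suc n) (factorials c) (λ m → Σgaps (n ∸ m) (λ L → profiled c (m ∷ L))) ⟨
      sum< (suc n) (λ m → factorials c * Σgaps (n ∸ m) (λ L → profiled c (m ∷ L)))
        ≡⟨ sum<-cong (suc n) (λ m m<1+n → first-gap n c m (≤-pred m<1+n) (ih (s≤s (m∸n≤m n m)) (decrementAt m c))) ⟩
      sum< (suc n) (λ m → X * (𝟙 (m ≤ᵇ R) * c m))
        ≡⟨ sum<-* (suc n) X (λ m → 𝟙 (m ≤ᵇ R) * c m) ⟩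
      X * sum< (suc n) (λ m → 𝟙 (m ≤ᵇ R) * c m)
        ≡⟨ closing ⟩
      𝟙 (eqℕ (weight c) (suc n)) * total c ! ∎
      where
      open ≡-Reasoning
      X : ℕ
      X = 𝟙 (eqℕ (weight c) (suc n)) * (total c ∸ 1) !
      closing : X * sum< (suc n) (λ m → 𝟙 (m ≤ᵇ R) * c m) ≡ 𝟙 (eqℕ (weight c) (suc n)) * total c !
      closing with eqℕ (weight c) (suc n) in w≡ᵇ1+n
      ... | false = refl
      ... | true = begin
        1 * (total c ∸ 1) ! * sum< (suc n) (λ m → 𝟙 (m ≤ᵇ R) * c m) ≡⟨ cong₂ _*_ (*-identityˡ ((total c ∸ 1) !)) (sum<-gapSizes c n w≡1+n) ⟩
        (total c ∸ 1) ! * total c                                   ≡⟨ pred!*≡! (weight≡suc⇒total>0 c n w≡1+n) ⟩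
        total c !                                                   ≡⟨ *-identityˡ (total c !) ⟨
        1 * total c !                                               ∎
        where
        w≡1+n : weight c ≡ suc n
        w≡1+n = eqℕ⇒≡ (weight c) (suc n) w≡ᵇ1+n

fromFin : (r : ℕ) → (Fin r → ℕ) → ℕ → ℕ
fromFin zero j i = 0
fromFin (suc r) j zero = j Fin.zero
fromFin (suc r) j (suc i) = fromFin r (λ x → j (Fin.suc x)) i

sumFin≡sum< : ∀ r (j : Fin r → ℕ) (g : ℕ → ℕ → ℕ) → sumFin r (λ i → g (toℕ i) (j i)) ≡ sum< r (λ i → g i (fromFin r j i))
sumFin≡sum< zero j g = refl
sumFin≡sum< (suc r) j g = cong (g 0 (j Fin.zero) +_) (sumFin≡sum< r (λ x → j (Fin.suc x)) (λ i → g (suc i)))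

prodFin≡prod< : ∀ r (j : Fin r → ℕ) (g : ℕ → ℕ → ℕ) → prodFin r (λ i → g (toℕ i) (j i)) ≡ prod< r (λ i → g i (fromFin r j i))
prodFin≡prod< zero j g = refl
prodFin≡prod< (suc r) j g = cong (g 0 (j Fin.zero) *_) (prodFin≡prod< r (λ x → j (Fin.suc x)) (λ i → g (suc i)))

allFinᵇ≡all< : ∀ r (j : Fin r → ℕ) (q : ℕ → ℕ → Bool) → allFinᵇ r (λ i → q (toℕ i) (j i)) ≡ all< r (λ i → q i (fromFin r j i))
allFinᵇ≡all< zero j q = refl
allFinᵇ≡all< (suc r) j q = cong (q 0 (j Fin.zero) ∧_) (allFinᵇ≡all< r (λ x → j (Fin.suc x)) (λ i → q (suc i)))

length-gapsFrom : ∀ g l → length (gapsFrom g l) ≡ suc (count (λ b → b) l)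
length-gapsFrom g [] = refl
length-gapsFrom g (false ∷ l) = length-gapsFrom (suc g) l
length-gapsFrom g (true ∷ l) = cong suc (length-gapsFrom 0 l)

∣∣≡count-toList : ∀ {n} (w : Subset n) → ∣ w ∣ ≡ count (λ b → b) (toList w)
∣∣≡count-toList [] = refl
∣∣≡count-toList (b ∷ w) = trans (∣∷∣ b w) (trans (cong (𝟙 b +_) (∣∣≡count-toList w)) (sym (count-∷ (λ b → b) b (toList w))))

length-gaps : ∀ {n} (w : Subset n) → length (gaps w) ≡ ∣ true ∷ w ∣
length-gaps w = trans (length-gapsFrom 0 (toList w)) (cong suc (sym (∣∣≡count-toList w)))

sum+length-gapsFrom : ∀ g l → sum (gapsFrom g l) + length (gapsFrom g l) ≡ g + suc (length l)
sum+length-gapsFrom g [] = cong (_+ 1) (+-identityʳ g)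
sum+length-gapsFrom g (false ∷ l) = trans (sum+length-gapsFrom (suc g) l) (sym (+-suc g (suc (length l))))
sum+length-gapsFrom g (true ∷ l) = begin
  g + sum (gapsFrom 0 l) + suc (length (gapsFrom 0 l))     ≡⟨ +-assoc g _ _ ⟩
  g + (sum (gapsFrom 0 l) + suc (length (gapsFrom 0 l)))   ≡⟨ cong (g +_) (+-suc _ _) ⟩
  g + suc (sum (gapsFrom 0 l) + length (gapsFrom 0 l))     ≡⟨ cong (λ s → g + suc s) (sum+length-gapsFrom 0 l) ⟩
  g + suc (suc (length l))                                 ∎
  where open ≡-Reasoning

sum+length-gaps : ∀ {n} (w : Subset n) → sum (gaps w) + length (gaps w) ≡ suc n
sum+length-gaps w = trans (sum+length-gapsFrom 0 (toList w)) (cong suc (length-toList w))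

all-≤ᵇ-sum : ∀ R L → sum L ≤ R → all (_≤ᵇ R) L ≡ true
all-≤ᵇ-sum R [] _ = refl
all-≤ᵇ-sum R (x ∷ L) x+ΣL≤R = cong₂ _∧_
  (≤⇒≤ᵇ≡true (≤-trans (m≤m+n x (sum L)) x+ΣL≤R))
  (all-≤ᵇ-sum R L (≤-trans (m≤n+m (sum L) x) x+ΣL≤R))

sum<-eqℕ : ∀ M x → x < M → sum< M (λ m → 𝟙 (eqℕ m x)) ≡ 1
sum<-eqℕ (suc M) zero _ = cong suc (sum<-0 M (λ _ _ → refl))
sum<-eqℕ (suc M) (suc x) (s≤s x<M) = sum<-eqℕ M x x<M

sum<-multiplicity : ∀ R L → all (_≤ᵇ R) L ≡ true → sum< (suc R) (λ m → multiplicity m L) ≡ length L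
sum<-multiplicity R [] _ = sum<-0 (suc R) (λ _ _ → refl)
sum<-multiplicity R (x ∷ L) x∷L≤R = begin
  sum< (suc R) (λ m → multiplicity m (x ∷ L))
    ≡⟨ sum<-cong (suc R) (λ m _ → multiplicity-∷ m x L) ⟩
  sum< (suc R) (λ m → 𝟙 (eqℕ m x) + multiplicity m L)
    ≡⟨ sum<-+ (suc R) (λ m → 𝟙 (eqℕ m x)) (λ m → multiplicity m L) ⟩
  sum< (suc R) (λ m → 𝟙 (eqℕ m x)) + sum< (suc R) (λ m → multiplicity m L)
    ≡⟨ cong₂ _+_ (sum<-eqℕ (suc R) x (s≤s x≤R)) (sum<-multiplicity R L (∧-conicalʳ _ _ x∷L≤R)) ⟩
  suc (length L) ∎
  where
  open ≡-Reasoning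
  x≤R : x ≤ R
  x≤R = ≤ᵇ≡true⇒≤ (∧-conicalˡ _ _ x∷L≤R)

module _ (n k : ℕ) (j : Fin (suc n ∸ k) → ℕ) (Σj≤k : sumFin (suc n ∸ k) j ≤ k)
         (k+Σj≡n : k + sumFin (suc n ∸ k) (λ i → suc (toℕ i) * j i) ≡ suc n) where

  private
    R Σj : ℕ
    R = suc n ∸ k
    Σj = sumFin R j

    -- c 0 = j_1 counts the gaps of length 0, c m = j_{m+1} the components of size m.
    c : ℕ → ℕ
    c zero = k ∸ Σj
    c (suc i) = fromFin R j i

    Σj≡ : Σj ≡ sum< R (fromFin R j)
    Σj≡ = sumFin≡sum< R j (λ _ v → v)

  open Profiles R

  total-profile : total c ≡ k
  total-profile = trans (cong ((k ∸ Σj) +_) (sym Σj≡)) (m∸n+n≡m Σj≤k)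

  weight-profile : weight c ≡ suc n
  weight-profile = begin
    1 * (k ∸ Σj) + sum< R (λ i → fromFin R j i + suc i * fromFin R j i)
      ≡⟨ cong₂ _+_ (*-identityˡ (k ∸ Σj)) (sum<-+ R (fromFin R j) (λ i → suc i * fromFin R j i)) ⟩
    (k ∸ Σj) + (sum< R (fromFin R j) + sum< R (λ i → suc i * fromFin R j i))
      ≡⟨ cong₂ (λ a b → (k ∸ Σj) + (a + b)) Σj≡ (sumFin≡sum< R j (λ i v → suc i * v)) ⟨
    (k ∸ Σj) + (Σj + sumFin R (λ i → suc (toℕ i) * j i))
      ≡⟨ +-assoc (k ∸ Σj) Σj _ ⟨
    (k ∸ Σj) + Σj + sumFin R (λ i → suc (toℕ i) * j i)
      ≡⟨ cong (_+ sumFin R (λ i → suc (toℕ i) * j i)) (m∸n+n≡m Σj≤k) ⟩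
    k + sumFin R (λ i → suc (toℕ i) * j i)
      ≡⟨ k+Σj≡n ⟩
    suc n ∎
    where open ≡-Reasoning

  factorials-profile : factorials c ≡ (k ∸ Σj) ! * prodFin R (λ i → j i !)
  factorials-profile = cong ((k ∸ Σj) ! *_) (sym (prodFin≡prod< R j (λ _ v → v !)))

  module _ (w : Subset n) where
    private
      L : List ℕ
      L = gaps w
      counts : Bool
      counts = all< R (λ i → eqℕ (multiplicity (suc i) L) (fromFin R j i))

      counts⇒Σ : counts ≡ true → sum< R (λ i → multiplicity (suc i) L) ≡ Σj
      counts⇒Σ h = trans (sum<-cong R (λ i i<R → eqℕ⇒≡ _ _ (all<⇒ R {λ i → eqℕ (multiplicity (suc i) L) (fromFin R j i)} h i i<R))) (sym Σj≡)

      length≡k⇒bounded : length L ≡ k → all (_≤ᵇ R) L ≡ true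
      length≡k⇒bounded ℓ≡k = all-≤ᵇ-sum R L (≤-reflexive (begin
        sum L                       ≡⟨ m+n∸n≡m (sum L) k ⟨
        sum L + k ∸ k               ≡⟨ cong (λ ℓ → sum L + ℓ ∸ k) ℓ≡k ⟨
        sum L + length L ∸ k        ≡⟨ cong (_∸ k) (sum+length-gaps w) ⟩
        R                           ∎))
        where open ≡-Reasoning

      zeros+Σ≡length : all (_≤ᵇ R) L ≡ true → multiplicity 0 L + sum< R (λ i → multiplicity (suc i) L) ≡ length L
      zeros+Σ≡length = sum<-multiplicity R L

      forward : eqℕ (length L) k ∧ counts ≡ true → hasProfile c L ≡ true
      forward h = cong₂ _∧_ bounded (cong₂ _∧_ (≡⇒eqℕ zeros) (∧-conicalʳ _ _ h))
        where
        ℓ≡k : length L ≡ k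
        ℓ≡k = eqℕ⇒≡ (length L) k (∧-conicalˡ _ _ h)
        bounded : all (_≤ᵇ R) L ≡ true
        bounded = length≡k⇒bounded ℓ≡k
        zeros : multiplicity 0 L ≡ k ∸ Σj
        zeros = begin
          multiplicity 0 L                              ≡⟨ m+n∸n≡m _ Σj ⟨
          multiplicity 0 L + Σj ∸ Σj                    ≡⟨ cong (λ s → multiplicity 0 L + s ∸ Σj) (counts⇒Σ (∧-conicalʳ _ _ h)) ⟨
          multiplicity 0 L + sum< R (λ i → multiplicity (suc i) L) ∸ Σj ≡⟨ cong (_∸ Σj) (trans (zeros+Σ≡length bounded) ℓ≡k) ⟩
          k ∸ Σj                                        ∎
          where open ≡-Reasoning

      backward : hasProfile c L ≡ true → eqℕ (length L) k ∧ counts ≡ true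
      backward h = cong₂ _∧_ (≡⇒eqℕ ℓ≡k) counts-ok
        where
        bounded : all (_≤ᵇ R) L ≡ true
        bounded = ∧-conicalˡ _ _ h
        zeros-ok : eqℕ (multiplicity 0 L) (k ∸ Σj) ≡ true
        zeros-ok = ∧-conicalˡ _ (counts) (∧-conicalʳ (all (_≤ᵇ R) L) _ h)
        counts-ok : counts ≡ true
        counts-ok = ∧-conicalʳ (eqℕ (multiplicity 0 L) (k ∸ Σj)) _ (∧-conicalʳ (all (_≤ᵇ R) L) _ h)
        ℓ≡k : length L ≡ k
        ℓ≡k = begin
          length L                                               ≡⟨ zeros+Σ≡length bounded ⟨
          multiplicity 0 L + sum< R (λ i → multiplicity (suc i) L) ≡⟨ cong₂ _+_ (eqℕ⇒≡ _ _ zeros-ok) (counts⇒Σ counts-ok) ⟩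
          k ∸ Σj + Σj                                            ≡⟨ m∸n+n≡m Σj≤k ⟩
          k                                                      ∎
          where open ≡-Reasoning

    goodDecomp-true-∷ : goodDecomp (suc n) k j (true ∷ w) ≡ hasProfile c (gaps w)
    goodDecomp-true-∷ = begin
      goodDecomp (suc n) k j (true ∷ w)
        ≡⟨ cong₂ _∧_ (cong (λ s → eqℕ s k) (sym (length-gaps w)))
                     (allFinᵇ-cong R (λ i → cong (λ m → eqℕ m (j i)) (numComponents-true-∷ w (toℕ i)))) ⟩
      eqℕ (length L) k ∧ allFinᵇ R (λ i → eqℕ (multiplicity (suc (toℕ i)) L) (j i))
        ≡⟨ cong (eqℕ (length L) k ∧_) (allFinᵇ≡all< R j (λ i v → eqℕ (multiplicity (suc i) L) v)) ⟩
      eqℕ (length L) k ∧ counts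
        ≡⟨ ⇔→≡ (mk⇔ forward backward) ⟩
      hasProfile c L ∎
      where open ≡-Reasoning

  decomps-through-0 : ΣSubset n (λ w → 𝟙 (goodDecomp (suc n) k j (true ∷ w))) * ((k ∸ Σj) ! * prodFin R (λ i → j i !)) ≡ k !
  decomps-through-0 = begin
    ΣSubset n (λ w → 𝟙 (goodDecomp (suc n) k j (true ∷ w))) * ((k ∸ Σj) ! * prodFin R (λ i → j i !))
      ≡⟨ cong₂ _*_ (ΣSubset-cong n (λ w → cong 𝟙 (goodDecomp-true-∷ w))) (sym factorials-profile) ⟩
    Σgaps (suc n) (profiled c) * factorials c
      ≡⟨ multinomial (suc n) c ⟩
    𝟙 (eqℕ (weight c) (suc n)) * total c !
      ≡⟨ cong₂ (λ w t → 𝟙 (eqℕ w (suc n)) * t !) weight-profile total-profile ⟩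
    𝟙 (eqℕ (suc n) (suc n)) * k !
      ≡⟨ cong (λ b → 𝟙 b * k !) (eqℕ-refl (suc n)) ⟩
    1 * k !
      ≡⟨ *-identityˡ (k !) ⟩
    k ! ∎
    where open ≡-Reasoning

proposition4p2 : (n k : ℕ) → 1 ≤ k → (j : Fin (n ∸ k) → ℕ)
    → sumFin (n ∸ k) j ≤ k
    → k + sumFin (n ∸ k) (λ i → suc (toℕ i) * j i) ≡ n
    → numDecomps n k j * ((k ∸ sumFin (n ∸ k) j) ! * prodFin (n ∸ k) (λ i → j i !))
      ≡ n * (k ∸ 1) !
proposition4p2 zero (suc k) _ j _ ()
proposition4p2 (suc n) (suc k) _ j Σj≤k k+Σj≡n = *-cancelˡ-≡ (D * P) (suc n * k !) (suc k) (begin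
  suc k * (D * P)         ≡⟨ *-assoc (suc k) D P ⟨
  suc k * D * P           ≡⟨ cong (_* P) (rotation-double-count (suc k) good (goodDecomp-rotate n (suc k) j) good⇒∣S∣≡k) ⟩
  suc n * B * P           ≡⟨ *-assoc (suc n) B P ⟩
  suc n * (B * P)         ≡⟨ cong (suc n *_) (decomps-through-0 n (suc k) j Σj≤k k+Σj≡n) ⟩
  suc n * suc k !         ≡⟨ *-CS.x∙yz≈y∙xz (suc n) (suc k) (k !) ⟩
  suc k * (suc n * k !)   ∎)
  where
  open ≡-Reasoning
  good : Subset (suc n) → Bool
  good = goodDecomp (suc n) (suc k) j
  D B P : ℕ
  D = numDecomps (suc n) (suc k) j
  B = ΣSubset n (λ w → 𝟙 (good (true ∷ w)))
  P = (suc k ∸ sumFin (suc n ∸ suc k) j) ! * prodFin (suc n ∸ suc k) (λ i → j i !)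
  good⇒∣S∣≡k : ∀ S → good S ≡ true → ∣ S ∣ ≡ suc k
  good⇒∣S∣≡k S h = eqℕ⇒≡ ∣ S ∣ (suc k) (∧-conicalˡ _ _ h)
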